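{- Let $G$ and $H$ be connected non complete graphs. Let $g_1,g_2\in V(G)$ be non adjacent vertices and $h_1,h_2\in V(H)$ be non adjacent vertices. Then $$WT_{G[H]}((g_1,h_1),(g_2,h_2))=\{(g,h): g\in WT_G(g_1,g_2),\ h\in V(H)\}\setminus X,$$ where $X=N_{{}^{g_1}H}((g_1,h_1))\cup N_{{}^{g_2}H}((g_2,h_2))=\{(g_1,h): hh_1\in E(H)\}\cup\{(g_2,h): hh_2\in E(H)\}$.
   Context: All graphs are finite, simple, connected and have at least two vertices. For vertices $u,v$ of a graph $G$, a weakly toll walk between $u$ and $v$ is a sequence $u=w_0,w_1,\ldots,w_k=v$ ($k\ge 0$) such that, when $k>0$: $w_iw_{i+1}\in E(G)$ for all $i\in\{0,\ldots,k-1\}$; $uw_i\in E(G)$ with $i\in\{1,\ldots,k\}$ implies $w_i=w_1$; and $w_iv\in E(G)$ with $i\in\{0,\ldots,k-1\}$ implies $w_i=w_{k-1}$. $WT_G(u,v)$ is the set of vertices lying on some weakly toll walk between $u$ and $v$. The lexicographic product $G[H]$ has vertex set $V(G)\times V(H)$, with $(g_1,h_1)(g_2,h_2)$ an edge iff $g_1g_2\in E(G)$, or $g_1=g_2$ and $h_1h_2\in E(H)$. For $g\in V(G)$, ${}^{g}H=\{(g,h):h\in V(H)\}$ is the $H$-layer (as an induced subgraph), and $N_{{}^{g}H}(\cdot)$ is the open neighbourhood within that layer. -}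

module Defs where

open import Data.Nat using (ℕ; zero; suc; _≤_; _<_; _∸_)
open import Data.Fin using (Fin)
open import Data.Bool using (Bool; true; false)
open import Data.Product using (Σ; ∃; ∃-syntax; _×_; _,_; proj₁; proj₂)
open import Data.Sum using (_⊎_)
open import Relation.Binary.PropositionalEquality using (_≡_)
open import Relation.Nullary using (¬_)

-- Walks in an arbitrary relation, encoded as a length k and a function ℕ → A
-- (only the values at 0..k matter).
IsWalk : {A : Set} → (A → A → Set) → A → A → (k : ℕ) → (ℕ → A) → Set
IsWalk E u v k w =
  (w 0 ≡ u) × (w k ≡ v) × (∀ i → i < k → E (w i) (w (suc i)))

IsWeaklyTollWalk : {A : Set} → (A → A → Set) → A → A → (k : ℕ) → (ℕ → A) → Set
IsWeaklyTollWalk E u v k w =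
  IsWalk E u v k w
  × (∀ i → 1 ≤ i → i ≤ k → E u (w i) → w i ≡ w 1)
  × (∀ i → i < k → E (w i) v → w i ≡ w (k ∸ 1))

InWT : {A : Set} → (A → A → Set) → A → A → A → Set
InWT E u v x = ∃[ k ] ∃[ w ] (IsWeaklyTollWalk E u v k w × ∃[ i ] (i ≤ k × w i ≡ x))

record Graph : Set where
  field
    n     : ℕ
    two≤n : 2 ≤ n
    adj   : Fin n → Fin n → Bool
    sym   : ∀ u v → adj u v ≡ adj v u
    irr   : ∀ u → adj u u ≡ false
  E : Fin n → Fin n → Set
  E u v = adj u v ≡ true
  field
    connected : ∀ u v → ∃[ k ] ∃[ w ] IsWalk E u v k w

open Graph public

V : Graph → Set
V G = Fin (n G)

NonComplete : Graph → Set
NonComplete G = ∃[ u ] ∃[ v ] (¬ u ≡ v × ¬ E G u v)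

LexE : (G H : Graph) → V G × V H → V G × V H → Set
LexE G H (g₁ , h₁) (g₂ , h₂) = E G g₁ g₂ ⊎ (g₁ ≡ g₂ × E H h₁ h₂)

-- A weakly toll walk in G[H] from (g₁,h₁) to (g₂,h₂) projects to a lazy walk in G whose
-- vertices adjacent to g₁ (resp. g₂) all coincide; deleting the repetitions leaves a weakly
-- toll walk in G through the same vertices.  The walk must leave the layer of g₁ along a
-- G-edge, and every neighbour of (g₁,h₁) on the walk is its second vertex, so that vertex is
-- outside the layer and no vertex (g₁,h) with h ~ h₁ is visited; the end is symmetric by
-- reversing walks.  Conversely, a weakly toll walk in G lifts layerwise to G[H], and a vertex
-- (g₁,h) with h ≁ h₁ is reached by the detour w₀ w₁ (g₁,h) w₁ w₂ ….
module Submission where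

open import Defs
open import Data.Product using (_×_; _,_)
open import Data.Sum using (_⊎_)
open import Relation.Binary.PropositionalEquality using (_≡_)
open import Relation.Nullary using (¬_)
open import Function.Bundles using (_⇔_)

open import Data.Nat using (ℕ; zero; suc; _≤_; _<_; _∸_; z≤n; s≤s; z<s)
open import Data.Nat.Properties
  using (≤-refl; ≤-trans; <⇒≤; ≤∧≢⇒<; m∸n≤m; n∸n≡0; m∸[m∸n]≡n; ∸-monoʳ-<; m<n⇒0<n∸m; +-∸-assoc)
import Data.Nat.Properties as ℕ
open import Data.Fin using (_≟_)
open import Data.Product using (∃-syntax; proj₁; proj₂)
open import Data.Sum using (inj₁; inj₂; map₂; [_,_])
open import Function.Base using (id; _∘_)
open import Function.Bundles using (mk⇔)
open import Relation.Nullary using (yes; no; contradiction)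
open import Relation.Unary using (Decidable; _⊆_; _≐_)
open import Relation.Unary.Properties using (≐-sym; ≐-trans)
open import Relation.Binary.Definitions using (Symmetric; DecidableEquality)
open import Relation.Binary.Construct.Closure.Reflexive as Refl using (ReflClosure)
open import Relation.Binary.PropositionalEquality as ≡ using (refl; trans; cong; subst)

private variable
  A B : Set
  R S : A → A → Set
  u v x a b : A
  k : ℕ
  w : ℕ → A

OnWalk : ℕ → (ℕ → A) → A → Set
OnWalk k w x = ∃[ i ] (i ≤ k × w i ≡ x)

OnWalk-map : (f : A → B) → OnWalk k w x → OnWalk k (λ i → f (w i)) (f x)
OnWalk-map f (i , i≤k , eq) = i , i≤k , cong f eq

OnWalk-suc : OnWalk (suc k) w ≐ (λ x → w 0 ≡ x ⊎ OnWalk k (λ i → w (suc i)) x)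
OnWalk-suc = to , from
  where
  to : OnWalk (suc k) w ⊆ (λ x → w 0 ≡ x ⊎ OnWalk k (λ i → w (suc i)) x)
  to (zero , _ , eq) = inj₁ eq
  to (suc i , s≤s i≤k , eq) = inj₂ (i , i≤k , eq)
  from : (λ x → w 0 ≡ x ⊎ OnWalk k (λ i → w (suc i)) x) ⊆ OnWalk (suc k) w
  from (inj₁ eq) = 0 , z≤n , eq
  from (inj₂ (i , i≤k , eq)) = suc i , s≤s i≤k , eq

exit : {P : ℕ → Set} → Decidable P → ∀ k → P 0 → ¬ P k → ∃[ i ] (i < k × P i × ¬ P (suc i))
exit P? zero p₀ ¬pₖ = contradiction p₀ ¬pₖ
exit P? (suc k) p₀ ¬pₖ₊₁ with P? k
... | yes pₖ = k , ≤-refl , pₖ , ¬pₖ₊₁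
... | no ¬pₖ with exit P? k p₀ ¬pₖ
...   | i , i<k , pᵢ , ¬pᵢ₊₁ = i , ℕ.m<n⇒m<1+n i<k , pᵢ , ¬pᵢ₊₁

IsWalk-map : (f : A → B) → (∀ {a b} → R a b → S (f a) (f b)) →
             IsWalk R u v k w → IsWalk S (f u) (f v) k (λ i → f (w i))
IsWalk-map f f-edge (w₀ , wₖ , step) = cong f w₀ , cong f wₖ , λ i i<k → f-edge (step i i<k)

first-edge : IsWalk R u v k w → 0 < k → R u (w 1)
first-edge (refl , _ , step) 0<k = step 0 0<k

last-edge : IsWalk R u v k w → 0 < k → R (w (k ∸ 1)) v
last-edge {k = suc k} {w = w} (_ , refl , step) _ = step k ≤-refl

length≥2 : IsWalk R u v k w → ¬ u ≡ v → ¬ R u v → 2 ≤ k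
length≥2 {k = zero} (refl , refl , _) u≢v _ = contradiction refl u≢v
length≥2 {k = suc zero} (refl , refl , step) _ u≁v = contradiction (step 0 z<s) u≁v
length≥2 {k = suc (suc k)} _ _ _ = s≤s (s≤s z≤n)

WalkWithVertices : (A → A → Set) → A → A → (A → Set) → Set
WalkWithVertices R u v P = ∃[ m ] ∃[ c ] (IsWalk R u v m c × OnWalk m c ≐ P)

_◂_ : A → (ℕ → A) → ℕ → A
(a ◂ c) zero = a
(a ◂ c) (suc i) = c i

prepend : {P : A → Set} → ReflClosure R a b → WalkWithVertices R b v P →
          WalkWithVertices R a v (λ x → a ≡ x ⊎ P x)
prepend Refl.refl (m , c , walk@(c₀ , _) , c⊆P , P⊆c) =
  m , c , walk , inj₂ ∘ c⊆P , λ { (inj₁ refl) → 0 , z≤n , c₀ ; (inj₂ p) → P⊆c p }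
prepend {R = R} {a = a} Refl.[ e ] (m , c , (refl , cₘ , step) , c≐P) =
  suc m , a ◂ c , (refl , cₘ , step′) , ≐-trans OnWalk-suc (map₂ (proj₁ c≐P) , map₂ (proj₂ c≐P))
  where
  step′ : ∀ i → i < suc m → R ((a ◂ c) i) ((a ◂ c) (suc i))
  step′ zero _ = e
  step′ (suc i) (s≤s i<m) = step i i<m

WalkWithVertices-≐ : {P Q : A → Set} → P ≐ Q → WalkWithVertices R u v P → WalkWithVertices R u v Q
WalkWithVertices-≐ P≐Q (m , c , walk , c≐P) = m , c , walk , ≐-trans c≐P P≐Q

compress : IsWalk (ReflClosure R) u v k w → WalkWithVertices R u v (OnWalk k w)
compress {k = zero} {w = w} walk = 0 , w , (proj₁ walk , proj₁ (proj₂ walk) , λ _ ()) , id , id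
compress {R = R} {k = suc k} (refl , wₖ , step) =
  WalkWithVertices-≐ {R = R} (≐-sym OnWalk-suc)
    (prepend (step 0 z<s) (compress (refl , wₖ , λ i i<k → step (suc i) (s≤s i<k))))

weaklyToll-intro : IsWalk R u v k w →
                   (∀ {x} → OnWalk k w x → R u x → x ≡ a) →
                   (∀ {x} → OnWalk k w x → R x v → x ≡ b) →
                   IsWeaklyTollWalk R u v k w
weaklyToll-intro {R = R} {u = u} {v = v} {k = k} {w = w} walk start end = walk , toll₁ , toll₂
  where
  toll₁ : ∀ i → 1 ≤ i → i ≤ k → R u (w i) → w i ≡ w 1
  toll₁ i 1≤i i≤k e = trans (start (i , i≤k , refl) e)
    (≡.sym (start (1 , ≤-trans 1≤i i≤k , refl) (first-edge {R = R} {w = w} walk (≤-trans 1≤i i≤k))))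
  toll₂ : ∀ i → i < k → R (w i) v → w i ≡ w (k ∸ 1)
  toll₂ i i<k e = trans (end (i , <⇒≤ i<k , refl) e)
    (≡.sym (end (k ∸ 1 , m∸n≤m k 1 , refl) (last-edge {R = R} {w = w} walk (≤-trans z<s i<k))))

neighbour-of-start : IsWeaklyTollWalk R u v k w → ¬ R u u → OnWalk k w x → R u x → x ≡ w 1
neighbour-of-start ((refl , _) , _) u≁u (zero , _ , refl) e = contradiction e u≁u
neighbour-of-start (_ , toll₁ , _) _ (suc i , i≤k , refl) e = toll₁ (suc i) (s≤s z≤n) i≤k e

neighbour-of-end : IsWeaklyTollWalk R u v k w → ¬ R v v → OnWalk k w x → R x v → x ≡ w (k ∸ 1)
neighbour-of-end {R = R} {v = v} {k = k} ((_ , wₖ , _) , _ , toll₂) v≁v (i , i≤k , refl) e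
  with i ℕ.≟ k
... | yes refl = contradiction (subst (λ y → R y v) wₖ e) v≁v
... | no i≢k = toll₂ i (≤∧≢⇒< i≤k i≢k) e

second-vertex≢start : DecidableEquality A → IsWalk {A = A} (ReflClosure R) u v k w → ¬ u ≡ v →
                 (∀ {x} → OnWalk k w x → R u x → x ≡ w 1) → ¬ w 1 ≡ u
second-vertex≢start {R = R} {u = u} {k = k} {w = w} _≟ᴬ_ (w₀ , wₖ , step) u≢v start w₁≡u
  with exit (λ i → w i ≟ᴬ u) k w₀ (λ wₖ≡u → u≢v (trans (≡.sym wₖ≡u) wₖ))
... | i , i<k , wᵢ≡u , wᵢ₊₁≢u =
  wᵢ₊₁≢u (trans (start (suc i , i<k , refl) (leave (step i i<k) wᵢ≡u wᵢ₊₁≢u)) w₁≡u)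
  where
  leave : ∀ {a b} → ReflClosure R a b → a ≡ u → ¬ b ≡ u → R u b
  leave Refl.refl a≡u b≢u = contradiction a≡u b≢u
  leave Refl.[ e ] refl _ = e

reverse : ℕ → (ℕ → A) → ℕ → A
reverse k w i = w (k ∸ i)

suc[k∸suc[i]]≡k∸i : ∀ {i} → i < k → suc (k ∸ suc i) ≡ k ∸ i
suc[k∸suc[i]]≡k∸i i<k = ≡.sym (+-∸-assoc 1 i<k)

IsWeaklyTollWalk-reverse : Symmetric R → IsWeaklyTollWalk R u v k w →
                           IsWeaklyTollWalk R v u k (reverse k w)
IsWeaklyTollWalk-reverse {R = R} {u = u} {v = v} {k = k} {w = w} R-sym
  ((w₀ , wₖ , step) , toll₁ , toll₂) =
  (wₖ , trans (cong w (n∸n≡0 k)) w₀ , step′) , toll₁′ , toll₂′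
  where
  step′ : ∀ i → i < k → R (w (k ∸ i)) (w (k ∸ suc i))
  step′ i i<k = subst (λ j → R (w j) (w (k ∸ suc i))) (suc[k∸suc[i]]≡k∸i i<k)
    (R-sym (step (k ∸ suc i) (∸-monoʳ-< z<s i<k)))
  toll₁′ : ∀ i → 1 ≤ i → i ≤ k → R v (w (k ∸ i)) → w (k ∸ i) ≡ w (k ∸ 1)
  toll₁′ i 1≤i i≤k e = toll₂ (k ∸ i) (∸-monoʳ-< 1≤i i≤k) (R-sym e)
  toll₂′ : ∀ i → i < k → R (w (k ∸ i)) u → w (k ∸ i) ≡ w (k ∸ (k ∸ 1))
  toll₂′ i i<k e = trans (toll₁ (k ∸ i) (m<n⇒0<n∸m i<k) (m∸n≤m k i) (R-sym e))
    (cong w (≡.sym (m∸[m∸n]≡n (≤-trans z<s i<k))))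

OnWalk-reverse : OnWalk k w ⊆ OnWalk k (reverse k w)
OnWalk-reverse {k = k} {w = w} (i , i≤k , refl) = k ∸ i , m∸n≤m k i , cong w (m∸[m∸n]≡n i≤k)

InWT-sym : Symmetric R → InWT R u v x → InWT R v u x
InWT-sym R-sym (k , w , toll , on) =
  k , reverse k w , IsWeaklyTollWalk-reverse R-sym toll , OnWalk-reverse on

detour : (ℕ → A) → A → ℕ → A
detour w x zero = w 0
detour w x (suc zero) = w 1
detour w x (suc (suc zero)) = x
detour w x (suc (suc (suc i))) = w (suc i)

InWT-detour : IsWeaklyTollWalk R u v k w → 2 ≤ k → R (w 1) x → R x (w 1) →
              ¬ R u x → ¬ R x v → InWT R u v x
InWT-detour {k = suc zero} _ (s≤s ()) _ _ _ _
InWT-detour {R = R} {u = u} {v = v} {k = suc (suc k)} {w = w} {x = x}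
  ((w₀ , wₖ , step) , toll₁ , toll₂) _ w₁x xw₁ u≁x x≁v =
  suc (suc (suc (suc k))) , D , ((w₀ , wₖ , step′) , toll₁′ , toll₂′) , 2 , s≤s (s≤s z≤n) , refl
  where
  D : ℕ → _
  D = detour w x
  step′ : ∀ i → i < suc (suc (suc (suc k))) → R (D i) (D (suc i))
  step′ zero _ = step 0 z<s
  step′ (suc zero) _ = w₁x
  step′ (suc (suc zero)) _ = xw₁
  step′ (suc (suc (suc i))) (s≤s (s≤s (s≤s i<))) = step (suc i) (s≤s i<)
  toll₁′ : ∀ i → 1 ≤ i → i ≤ suc (suc (suc (suc k))) → R u (D i) → D i ≡ D 1
  toll₁′ (suc zero) _ _ _ = refl
  toll₁′ (suc (suc zero)) _ _ e = contradiction e u≁x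
  toll₁′ (suc (suc (suc i))) _ (s≤s (s≤s (s≤s i≤))) e = toll₁ (suc i) (s≤s z≤n) (s≤s i≤) e
  toll₂′ : ∀ i → i < suc (suc (suc (suc k))) → R (D i) v → D i ≡ D (suc (suc (suc k)))
  toll₂′ zero _ e = toll₂ 0 z<s e
  toll₂′ (suc zero) _ e = toll₂ 1 (s≤s (s≤s z≤n)) e
  toll₂′ (suc (suc zero)) _ e = contradiction e x≁v
  toll₂′ (suc (suc (suc i))) (s≤s (s≤s (s≤s i<))) e = toll₂ (suc i) (s≤s i<) e

E-sym : (Γ : Graph) → Symmetric (E Γ)
E-sym Γ {a} {b} e = trans (Graph.sym Γ b a) e

E-irrefl : (Γ : Graph) {a : V Γ} → ¬ E Γ a a
E-irrefl Γ {a} e = contradiction (trans (≡.sym (irr Γ a)) e) λ ()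

module Piecewise {A B : Set} (_≟ᴬ_ : DecidableEquality A) (a₁ a₂ : A) (b₁ b₂ b : B) where

  piecewise : A → B
  piecewise x with x ≟ᴬ a₁ | x ≟ᴬ a₂
  ... | yes _ | _     = b₁
  ... | no _  | yes _ = b₂
  ... | no _  | no _  = b

  piecewise-first : piecewise a₁ ≡ b₁
  piecewise-first with a₁ ≟ᴬ a₁
  ... | yes _ = refl
  ... | no a₁≢a₁ = contradiction refl a₁≢a₁

  piecewise-second : ¬ a₁ ≡ a₂ → piecewise a₂ ≡ b₂
  piecewise-second a₁≢a₂ with a₂ ≟ᴬ a₁ | a₂ ≟ᴬ a₂
  ... | yes a₂≡a₁ | _ = contradiction (≡.sym a₂≡a₁) a₁≢a₂
  ... | no _ | yes _ = refl
  ... | no _ | no a₂≢a₂ = contradiction refl a₂≢a₂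

  piecewise-other : {x : A} → ¬ x ≡ a₁ → ¬ x ≡ a₂ → piecewise x ≡ b
  piecewise-other {x} x≢a₁ x≢a₂ with x ≟ᴬ a₁ | x ≟ᴬ a₂
  ... | yes x≡a₁ | _ = contradiction x≡a₁ x≢a₁
  ... | no _ | yes x≡a₂ = contradiction x≡a₂ x≢a₂
  ... | no _ | no _ = refl

module Lex (G H : Graph) where

  private
    L : V G × V H → V G × V H → Set
    L = LexE G H

  LexE-sym : Symmetric L
  LexE-sym (inj₁ e) = inj₁ (E-sym G e)
  LexE-sym (inj₂ (eq , e)) = inj₂ (≡.sym eq , E-sym H e)

  LexE-irrefl : ¬ L a a
  LexE-irrefl (inj₁ e) = E-irrefl G e
  LexE-irrefl (inj₂ (_ , e)) = E-irrefl H e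

  proj-step : L a b → ReflClosure (E G) (proj₁ a) (proj₁ b)
  proj-step (inj₁ e) = Refl.[ e ]
  proj-step (inj₂ (eq , _)) = Refl.reflexive eq

  module Projection {g₁ g₂ : V G} {h₁ h₂ : V H} {k : ℕ} {W : ℕ → V G × V H}
                    (toll : IsWeaklyTollWalk L (g₁ , h₁) (g₂ , h₂) k W) where

    layer : ℕ → V G
    layer i = proj₁ (W i)

    lazy : IsWalk (ReflClosure (E G)) g₁ g₂ k layer
    lazy = IsWalk-map {R = L} proj₁ proj-step (proj₁ toll)

    start-neighbour : {x : V G} → OnWalk k layer x → E G g₁ x → x ≡ layer 1
    start-neighbour (i , i≤k , refl) e =
      cong proj₁ (neighbour-of-start {R = L} toll LexE-irrefl (i , i≤k , refl) (inj₁ e))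

    end-neighbour : {x : V G} → OnWalk k layer x → E G x g₂ → x ≡ layer (k ∸ 1)
    end-neighbour (i , i≤k , refl) e =
      cong proj₁ (neighbour-of-end {R = L} toll LexE-irrefl (i , i≤k , refl) (inj₁ e))

    second-leaves-start-layer : ¬ g₁ ≡ g₂ → ¬ layer 1 ≡ g₁
    second-leaves-start-layer g₁≢g₂ = second-vertex≢start _≟_ lazy g₁≢g₂ start-neighbour

  open Projection using (lazy; start-neighbour; end-neighbour; second-leaves-start-layer)

  InWT-proj : ∀ {g₁ g₂ g h₁ h₂ h} → InWT L (g₁ , h₁) (g₂ , h₂) (g , h) → InWT (E G) g₁ g₂ g
  InWT-proj (k , W , toll , on) with compress (lazy toll)
  ... | m , c , walk , c⊆W , W⊆c =
    m , c , weaklyToll-intro walk (start-neighbour toll ∘ c⊆W) (end-neighbour toll ∘ c⊆W) ,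
    W⊆c (OnWalk-map proj₁ on)

  InWT-∉-start-neighbourhood : ∀ {g₁ g₂ g h₁ h₂ h} → ¬ g₁ ≡ g₂ →
    InWT L (g₁ , h₁) (g₂ , h₂) (g , h) → ¬ (g ≡ g₁ × E H h h₁)
  InWT-∉-start-neighbourhood g₁≢g₂ (k , W , toll , on) (refl , e) =
    second-leaves-start-layer toll g₁≢g₂
      (≡.sym (cong proj₁ (neighbour-of-start {R = L} toll LexE-irrefl on
        (inj₂ (refl , E-sym H e)))))

  lift-weaklyToll : ∀ {g₁ g₂ k w} (f : V G → V H) → IsWeaklyTollWalk (E G) g₁ g₂ k w →
    IsWeaklyTollWalk L (g₁ , f g₁) (g₂ , f g₂) k (λ i → w i , f (w i))
  lift-weaklyToll {g₁} {g₂} {k} {w} f (walk , toll₁ , toll₂) =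
    IsWalk-map {R = E G} {S = L} {w = w} lift inj₁ walk , toll₁′ , toll₂′
    where
    lift : V G → V G × V H
    lift x = x , f x
    toll₁′ : ∀ i → 1 ≤ i → i ≤ k → L (lift g₁) (lift (w i)) → lift (w i) ≡ lift (w 1)
    toll₁′ i 1≤i i≤k (inj₁ e) = cong lift (toll₁ i 1≤i i≤k e)
    toll₁′ i _ _ (inj₂ (g₁≡wᵢ , e)) =
      contradiction (subst (λ y → E H (f g₁) (f y)) (≡.sym g₁≡wᵢ) e) (E-irrefl H)
    toll₂′ : ∀ i → i < k → L (lift (w i)) (lift g₂) → lift (w i) ≡ lift (w (k ∸ 1))
    toll₂′ i i<k (inj₁ e) = cong lift (toll₂ i i<k e)
    toll₂′ i _ (inj₂ (wᵢ≡g₂ , e)) =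
      contradiction (subst (λ y → E H (f y) (f g₂)) wᵢ≡g₂ e) (E-irrefl H)

  InWT-lift : ∀ {g₁ g₂ g h₁ h₂ h} (f : V G → V H) → f g₁ ≡ h₁ → f g₂ ≡ h₂ → f g ≡ h →
    InWT (E G) g₁ g₂ g → InWT L (g₁ , h₁) (g₂ , h₂) (g , h)
  InWT-lift f refl refl refl (k , w , toll , on) =
    k , _ , lift-weaklyToll f toll , OnWalk-map (λ x → x , f x) on

  InWT-start-layer : ∀ {g₁ g₂ g x h₁ h₂ h} (f : V G → V H) → f g₁ ≡ h₁ → f g₂ ≡ h₂ →
    ¬ g₁ ≡ g₂ → ¬ E G g₁ g₂ → InWT (E G) g₁ g₂ x → g ≡ g₁ → ¬ E H h h₁ →
    InWT L (g₁ , h₁) (g₂ , h₂) (g , h)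
  InWT-start-layer {g₁} {g₂} {h = h} f refl refl g₁≢g₂ g₁≁g₂ (k , w , toll , _) refl h≁h₁ =
    InWT-detour {R = L} (lift-weaklyToll f toll) 2≤k (inj₁ w₁g₁) (inj₁ (E-sym G w₁g₁)) u≁x x≁v
    where
    2≤k : 2 ≤ k
    2≤k = length≥2 {R = E G} {w = w} (proj₁ toll) g₁≢g₂ g₁≁g₂
    w₁g₁ : E G (w 1) g₁
    w₁g₁ = E-sym G (first-edge {R = E G} {w = w} (proj₁ toll) (≤-trans z<s 2≤k))
    u≁x : ¬ L (g₁ , f g₁) (g₁ , h)
    u≁x (inj₁ e) = E-irrefl G e
    u≁x (inj₂ (_ , e)) = h≁h₁ (E-sym H e)
    x≁v : ¬ L (g₁ , h) (g₂ , f g₂)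
    x≁v (inj₁ e) = g₁≁g₂ e
    x≁v (inj₂ (g₁≡g₂ , _)) = g₁≢g₂ g₁≡g₂

mainTheorem11 : (G H : Graph) → NonComplete G → NonComplete H →
    (g₁ g₂ : V G) → ¬ g₁ ≡ g₂ → ¬ E G g₁ g₂ →
    (h₁ h₂ : V H) → ¬ h₁ ≡ h₂ → ¬ E H h₁ h₂ →
    (g : V G) (h : V H) →
    InWT (LexE G H) (g₁ , h₁) (g₂ , h₂) (g , h)
      ⇔ (InWT (E G) g₁ g₂ g
          × ¬ (((g ≡ g₁) × E H h h₁) ⊎ ((g ≡ g₂) × E H h h₂)))
mainTheorem11 G H _ _ g₁ g₂ g₁≢g₂ g₁≁g₂ h₁ h₂ _ _ g h = mk⇔ to from
  where
  open Lex G H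

  g₂≢g₁ : ¬ g₂ ≡ g₁
  g₂≢g₁ = g₁≢g₂ ∘ ≡.sym

  to : InWT (LexE G H) (g₁ , h₁) (g₂ , h₂) (g , h) →
       InWT (E G) g₁ g₂ g × ¬ (((g ≡ g₁) × E H h h₁) ⊎ ((g ≡ g₂) × E H h h₂))
  to p = InWT-proj p ,
    [ InWT-∉-start-neighbourhood g₁≢g₂ p , InWT-∉-start-neighbourhood g₂≢g₁ (InWT-sym LexE-sym p) ]

  open Piecewise _≟_ g₁ g₂ h₁ h₂ h

  piecewise-g₂ : piecewise g₂ ≡ h₂
  piecewise-g₂ = piecewise-second g₁≢g₂

  from : InWT (E G) g₁ g₂ g × ¬ (((g ≡ g₁) × E H h h₁) ⊎ ((g ≡ g₂) × E H h h₂)) →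
         InWT (LexE G H) (g₁ , h₁) (g₂ , h₂) (g , h)
  from (p , ∉X) with g ≟ g₁ | g ≟ g₂
  ... | yes g≡g₁ | _ =
    InWT-start-layer piecewise piecewise-first piecewise-g₂ g₁≢g₂ g₁≁g₂
      p g≡g₁ (∉X ∘ inj₁ ∘ (g≡g₁ ,_))
  ... | no _ | yes g≡g₂ = InWT-sym LexE-sym
    (InWT-start-layer piecewise piecewise-g₂ piecewise-first g₂≢g₁ (g₁≁g₂ ∘ E-sym G)
      (InWT-sym (E-sym G) p) g≡g₂ (∉X ∘ inj₂ ∘ (g≡g₂ ,_)))
  ... | no g≢g₁ | no g≢g₂ =
    InWT-lift piecewise piecewise-first piecewise-g₂ (piecewise-other g≢g₁ g≢g₂) p
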